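{- Let $\pi=a_1a_2\cdots a_n$ be a permutation of $[n]$ and let $\pi=\pi_1\pi_2\cdots\pi_q$ be its factorization into indecomposable components. Then $\pi_q$ is the maximum-length indecomposable suffix of $\pi$.
   Context: Permutations are written in one-line notation and products are concatenations of words. A permutation $\sigma$ of $[k]=\{1,\dots,k\}$ is indecomposable if there is no $1\le j<k$ such that $\sigma(\{1,\dots,j\})=\{1,\dots,j\}$. For a word $w=b_1\cdots b_k$ of distinct integers, its reduced form is the permutation of $[k]$ obtained by replacing the $i$-th smallest entry by $i$; $w$ is called indecomposable if its reduced form is. A suffix of $\pi$ is a word $a_v a_{v+1}\cdots a_n$. The indecomposable components: $\pi_1$ is the longest indecomposable prefix of $\pi$; writing $\pi=\pi_1\pi'$, if $\pi'$ is nonempty its components are obtained recursively, giving $\pi=\pi_1\pi_2\cdots\pi_q$ with each $\pi_j$ indecomposable. -}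

module Defs where

open import Data.Nat using (ℕ; suc; _<_; _≤_; _<?_)
open import Data.List using (List; []; _∷_; _++_; map; upTo; take; length; filter; _∷ʳ_)
open import Data.List.Relation.Binary.Permutation.Propositional using (_↭_)
open import Data.Product using (Σ; ∃; _×_)
open import Relation.Binary.PropositionalEquality using (_≡_; _≢_)
open import Relation.Nullary using (¬_)

range1 : ℕ → List ℕ
range1 k = map suc (upTo k)

-- a list σ (one-line notation) is a permutation of [k]
IsPerm : ℕ → List ℕ → Set
IsPerm k σ = σ ↭ range1 k

-- σ (a permutation of [length σ]) is indecomposable: there is no 1 ≤ j < k
-- with σ({1,…,j}) = {1,…,j}, i.e. the first j entries are, as a multiset
-- (entries are distinct), exactly 1,…,j.
IndecPerm : List ℕ → Set
IndecPerm σ = ¬ (Σ ℕ λ j → (1 ≤ j) × (j < length σ) × (take j σ ↭ range1 j))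

-- Reduced form of a word of distinct integers: replace each entry b by
-- 1 + (number of entries smaller than b), i.e. the i-th smallest entry by i.
reduce : List ℕ → List ℕ
reduce w = map (λ b → suc (length (filter (_<? b) w))) w

Indec : List ℕ → Set
Indec w = IndecPerm (reduce w)

IsLongestIndecPrefix : List ℕ → List ℕ → Set
IsLongestIndecPrefix p w =
  p ≢ [] × (∃ λ u → w ≡ p ++ u) × Indec p ×
  (∀ p' → p' ≢ [] → (∃ λ u → w ≡ p' ++ u) → Indec p' → length p' ≤ length p)

-- Components w cs : cs = π₁ ∷ π₂ ∷ … ∷ π_q is the factorization of w into
-- indecomposable components (π₁ longest indecomposable prefix, recursively).
data Components : List ℕ → List (List ℕ) → Set where
  done : Components [] []
  step : ∀ {p u cs} → IsLongestIndecPrefix p (p ++ u) → Components u cs →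
         Components (p ++ u) (p ∷ cs)

-- a suffix a_v ⋯ a_n (1 ≤ v ≤ n, so nonempty)
IsSuffix : List ℕ → List ℕ → Set
IsSuffix s w = s ≢ [] × (∃ λ u → w ≡ u ++ s)

IsMaxIndecSuffix : List ℕ → List ℕ → Set
IsMaxIndecSuffix s w =
  IsSuffix s w × Indec s × (∀ s' → IsSuffix s' w → Indec s' → length s' ≤ length s)

{-# OPTIONS --safe #-}
-- For a word of distinct entries, the first j letters of its reduced form are a
-- permutation of [j] exactly when the first j entries all lie below the remaining
-- ones. So such a word is indecomposable iff it has no cut P ++ S with P, S
-- nonempty and every entry of P below every entry of S. The shortest nonempty
-- prefix lying below the rest is then indecomposable; comparing it with the
-- longest indecomposable prefix shows that every component lies below everything
-- after it. Hence π = A ++ πq with A below πq, and every longer suffix r ++ πq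
-- (r nonempty) is cut by r below πq.

module Submission where

open import Defs
open import Data.Nat using (ℕ; zero; suc; _+_; _<_; _≤_; _<?_; z≤n; s≤s)
open import Data.Nat.Properties
open import Data.List
  using (List; []; _∷_; _++_; map; upTo; take; drop; length; filter; _∷ʳ_; [_]; initLast; _∷ʳ′_)
open import Data.List.Properties
  using ( map-++; length-map; length-++; length-++-≤ʳ; take-map; take++drop≡id; length-take
        ; length-drop; filter-none; filter-all; filter-accept; filter-reject; filter-++
        ; map-cong-local; upTo-∷ʳ; ++-assoc; ++-identityʳ; ++-conicalʳ; ∷-injective; ∷ʳ-injective)
open import Data.List.Extrema.Nat using (max; xs≤max; ⊥≤max; argmax-sel)
open import Data.List.Relation.Unary.All as All using (All; []; _∷_)
import Data.List.Relation.Unary.All.Properties as All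
open import Data.List.Relation.Unary.AllPairs using ([]; _∷_)
open import Data.List.Relation.Unary.Any using (here; there)
open import Data.List.Relation.Unary.Unique.Propositional using (Unique)
import Data.List.Relation.Unary.Unique.Propositional.Properties as Unique
open import Data.List.Membership.Propositional using (_∈_; _∉_)
open import Data.List.Membership.Propositional.Properties
  using (∈-map⁺; ∈-map⁻; ∈-++⁺ˡ; ∈-++⁺ʳ; ∈-∃++; ∈-upTo⁺; ∈-upTo⁻)
open import Data.List.Relation.Binary.Permutation.Propositional
  using (_↭_; ↭-refl; ↭-sym; ↭-trans; ↭-prep; ↭-reflexive; ↭⇒↭ₛ; module PermutationReasoning)
open import Data.List.Relation.Binary.Permutation.Propositional.Properties
  using (∈-resp-↭; All-resp-↭; shift; ∷↭∷ʳ; map⁺; ↭-length; filter-↭)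
import Data.List.Relation.Binary.Permutation.Setoid.Properties as ↭ₛ
open import Data.List.Relation.Binary.Sublist.Propositional using (⊆-refl)
open import Data.List.Relation.Binary.Sublist.Propositional.Properties using (filter⁺)
open import Data.List.Relation.Binary.Sublist.Heterogeneous.Properties using (length-mono-≤)
open import Data.Product using (∃; ∃₂; _×_; _,_)
open import Data.Sum using (inj₁; inj₂)
open import Data.Empty using (⊥-elim)
open import Function using (_∘_)
open import Relation.Nullary using (¬_; Dec; yes; no)
open import Relation.Binary.Definitions using (tri<; tri≈; tri>)
open import Relation.Binary.PropositionalEquality
  using (_≡_; _≢_; refl; sym; trans; cong; cong₂; subst; subst₂; setoid; module ≡-Reasoning)

module _ {a} {A : Set a} where

  Unique-++⁻ˡ : ∀ (xs : List A) {ys} → Unique (xs ++ ys) → Unique xs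
  Unique-++⁻ˡ []       _             = []
  Unique-++⁻ˡ (_ ∷ xs) (x∉ ∷ unique) = All.++⁻ˡ xs x∉ ∷ Unique-++⁻ˡ xs unique

  Unique-++⁻ʳ : ∀ (xs : List A) {ys} → Unique (xs ++ ys) → Unique ys
  Unique-++⁻ʳ []       unique       = unique
  Unique-++⁻ʳ (_ ∷ xs) (_ ∷ unique) = Unique-++⁻ʳ xs unique

  Unique-++⇒disjoint : ∀ (xs : List A) {ys z} → Unique (xs ++ ys) → z ∈ xs → z ∉ ys
  Unique-++⇒disjoint (_ ∷ xs) (x≢ ∷ _)     (here refl)  z∈ys =
    All.lookup x≢ (∈-++⁺ʳ xs z∈ys) refl
  Unique-++⇒disjoint (_ ∷ xs) (_ ∷ unique) (there z∈xs) z∈ys =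
    Unique-++⇒disjoint xs unique z∈xs z∈ys

  take-length-++ : ∀ (xs ys : List A) → take (length xs) (xs ++ ys) ≡ xs
  take-length-++ []       ys = refl
  take-length-++ (x ∷ xs) ys = cong (x ∷_) (take-length-++ xs ys)

  ++-prefix-split : ∀ (P S P′ S′ : List A) → P ++ S ≡ P′ ++ S′ → length P ≤ length P′ →
                    ∃ λ R → P′ ≡ P ++ R × S ≡ R ++ S′
  ++-prefix-split []      S P′       S′ eq _              = P′ , refl , eq
  ++-prefix-split (_ ∷ P) S (_ ∷ P′) S′ eq (s≤s |P|≤|P′|)
    with refl , eq′ ← ∷-injective eq
    with R , refl , S≡R++S′ ← ++-prefix-split P S P′ S′ eq′ |P|≤|P′| = R , refl , S≡R++S′

  0<length⇒≢[] : ∀ {xs : List A} → 0 < length xs → xs ≢ []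
  0<length⇒≢[] {_ ∷ _} _ ()

  ≢[]⇒0<length : ∀ {xs : List A} → xs ≢ [] → 0 < length xs
  ≢[]⇒0<length {[]}    xs≢[] = ⊥-elim (xs≢[] refl)
  ≢[]⇒0<length {_ ∷ _} _     = s≤s z≤n

  ++≢[] : ∀ {xs ys : List A} → xs ≢ [] → xs ++ ys ≢ []
  ++≢[] {[]}    xs≢[] = ⊥-elim (xs≢[] refl)
  ++≢[] {_ ∷ _} _     ()

  ∷ʳ≢[] : ∀ (xs : List A) x → xs ∷ʳ x ≢ []
  ∷ʳ≢[] xs x eq with () ← ++-conicalʳ xs [ x ] eq

countBelow : ℕ → List ℕ → ℕ
countBelow b w = length (filter (_<? b) w)

rank : List ℕ → ℕ → ℕ
rank w b = suc (countBelow b w)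

countBelow-∷-< : ∀ {b c} w → c < b → countBelow b (c ∷ w) ≡ suc (countBelow b w)
countBelow-∷-< {b} _ c<b = cong length (filter-accept (_<? b) c<b)

countBelow-∷-≮ : ∀ {b c} w → ¬ c < b → countBelow b (c ∷ w) ≡ countBelow b w
countBelow-∷-≮ {b} _ c≮b = cong length (filter-reject (_<? b) c≮b)

countBelow-++ : ∀ b xs ys → countBelow b (xs ++ ys) ≡ countBelow b xs + countBelow b ys
countBelow-++ b xs ys = trans (cong length (filter-++ (_<? b) xs ys)) (length-++ (filter (_<? b) xs))

countBelow-↭ : ∀ b {xs ys} → xs ↭ ys → countBelow b xs ≡ countBelow b ys
countBelow-↭ b xs↭ys = ↭-length (filter-↭ (_<? b) xs↭ys)

countBelow-none : ∀ {b xs} → All (b ≤_) xs → countBelow b xs ≡ 0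
countBelow-none {b} b≤xs = cong length (filter-none (_<? b) (All.map ≤⇒≯ b≤xs))

countBelow-all : ∀ {b xs} → All (_< b) xs → countBelow b xs ≡ length xs
countBelow-all {b} xs<b = cong length (filter-all (_<? b) xs<b)

countBelow-mono : ∀ {a b} xs → a ≤ b → countBelow a xs ≤ countBelow b xs
countBelow-mono {a} {b} xs a≤b =
  length-mono-≤ (filter⁺ (_<? a) (_<? b) (λ { refl c<a → <-≤-trans c<a a≤b }) (⊆-refl {x = xs}))

countBelow-strict : ∀ {a b xs} → a ∈ xs → a < b → countBelow a xs < countBelow b xs
countBelow-strict {a} {b} a∈xs a<b with ∈-∃++ a∈xs
... | ys , zs , refl = begin-strict
  countBelow a (ys ++ a ∷ zs)              ≡⟨ countBelow-++ a ys (a ∷ zs) ⟩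
  countBelow a ys + countBelow a (a ∷ zs)  ≡⟨ cong (countBelow a ys +_) (countBelow-∷-≮ zs a≮a) ⟩
  countBelow a ys + countBelow a zs        <⟨ +-mono-≤-< (countBelow-mono ys a≤b) (s≤s (countBelow-mono zs a≤b)) ⟩
  countBelow b ys + suc (countBelow b zs)  ≡⟨ cong (countBelow b ys +_) (countBelow-∷-< zs a<b) ⟨
  countBelow b ys + countBelow b (a ∷ zs)  ≡⟨ countBelow-++ b ys (a ∷ zs) ⟨
  countBelow b (ys ++ a ∷ zs)              ∎
  where
  open ≤-Reasoning
  a≤b : a ≤ b
  a≤b = <⇒≤ a<b
  a≮a : ¬ a < a
  a≮a = <-irrefl refl

rank-injective : ∀ {w a b} → a ∈ w → b ∈ w → rank w a ≡ rank w b → a ≡ b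
rank-injective {a = a} {b} a∈w b∈w eq with <-cmp a b
... | tri< a<b _ _ = ⊥-elim (<⇒≢ (countBelow-strict a∈w a<b) (suc-injective eq))
... | tri≈ _ a≡b _ = a≡b
... | tri> _ _ b<a = ⊥-elim (<⇒≢ (countBelow-strict b∈w b<a) (suc-injective (sym eq)))

rank-↭ : ∀ {xs ys} → xs ↭ ys → ∀ b → rank xs b ≡ rank ys b
rank-↭ xs↭ys b = cong suc (countBelow-↭ b xs↭ys)

rank-++-above : ∀ {b} xs {ys} → All (b ≤_) ys → rank (xs ++ ys) b ≡ rank xs b
rank-++-above {b} xs {ys} b≤ys = cong suc (begin
  countBelow b (xs ++ ys)            ≡⟨ countBelow-++ b xs ys ⟩
  countBelow b xs + countBelow b ys  ≡⟨ cong (countBelow b xs +_) (countBelow-none b≤ys) ⟩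
  countBelow b xs + 0                ≡⟨ +-identityʳ _ ⟩
  countBelow b xs                    ∎)
  where open ≡-Reasoning

reduce-max-∷ : ∀ {m v} → All (_< m) v → reduce (m ∷ v) ≡ suc (length v) ∷ reduce v
reduce-max-∷ {m} {v} v<m = cong₂ _∷_ rank-max (map-cong-local (All.map rank-below v<m))
  where
  rank-max : rank (m ∷ v) m ≡ suc (length v)
  rank-max = cong suc (trans (countBelow-∷-≮ v (<-irrefl refl)) (countBelow-all v<m))
  rank-below : ∀ {c} → c < m → rank (m ∷ v) c ≡ rank v c
  rank-below c<m = cong suc (countBelow-∷-≮ v (<-asym c<m))

range1-suc : ∀ n → range1 (suc n) ≡ range1 n ∷ʳ suc n
range1-suc n = begin
  map suc (upTo (suc n))  ≡⟨ cong (map suc) (upTo-∷ʳ n) ⟨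
  map suc (upTo n ∷ʳ n)   ≡⟨ map-++ suc (upTo n) [ n ] ⟩
  range1 n ∷ʳ suc n       ∎
  where open ≡-Reasoning

∈-range1⁺ : ∀ {k n} → k < n → suc k ∈ range1 n
∈-range1⁺ k<n = ∈-map⁺ suc (∈-upTo⁺ k<n)

∈-range1⁻ : ∀ {k n} → suc k ∈ range1 n → k < n
∈-range1⁻ k+1∈ with ∈-map⁻ suc k+1∈
... | _ , k∈ , refl = ∈-upTo⁻ k∈

Unique-range1 : ∀ n → Unique (range1 n)
Unique-range1 n = Unique.map⁺ suc-injective (Unique.upTo⁺ n)

IsPerm⇒Unique : ∀ {n π} → IsPerm n π → Unique π
IsPerm⇒Unique {n} π↭range =
  ↭ₛ.Unique-resp-↭ (setoid ℕ) (↭⇒↭ₛ (↭-sym π↭range)) (Unique-range1 n)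

max∈ : ∀ x xs → max x xs ∈ x ∷ xs
max∈ x xs with argmax-sel (λ y → y) x xs
... | inj₁ max≡x  = here max≡x
... | inj₂ max∈xs = there max∈xs

reduce-↭-range1 : ∀ w → Unique w → reduce w ↭ range1 (length w)
reduce-↭-range1 w = go (length w) w refl
  where
  go : ∀ n w → length w ≡ n → Unique w → reduce w ↭ range1 n
  go zero    []           _   _      = ↭-refl
  go (suc n) w@(x ∷ xs) |w|≡1+n unique with ∈-∃++ (max∈ x xs)
  ... | ys , zs , w≡ys++m∷zs = begin
    map (rank w) w             ↭⟨ map⁺ (rank w) w↭m∷v ⟩
    map (rank w) (m ∷ v)       ≡⟨ map-cong-local (All.universal (rank-↭ w↭m∷v) (m ∷ v)) ⟩
    reduce (m ∷ v)             ≡⟨ reduce-max-∷ v<m ⟩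
    suc (length v) ∷ reduce v  ≡⟨ cong (λ k → suc k ∷ reduce v) |v|≡n ⟩
    suc n ∷ reduce v           ↭⟨ ↭-prep (suc n) (go n v |v|≡n v-unique) ⟩
    suc n ∷ range1 n           ↭⟨ ∷↭∷ʳ (suc n) (range1 n) ⟩
    range1 n ∷ʳ suc n          ≡⟨ range1-suc n ⟨
    range1 (suc n)             ∎
    where
    open PermutationReasoning
    m : ℕ
    m = max x xs
    v : List ℕ
    v = ys ++ zs
    w↭m∷v : w ↭ m ∷ v
    w↭m∷v = ↭-trans (↭-reflexive w≡ys++m∷zs) (shift m ys zs)
    m∷v-unique : Unique (m ∷ v)
    m∷v-unique = ↭ₛ.Unique-resp-↭ (setoid ℕ) (↭⇒↭ₛ w↭m∷v) unique
    v-unique : Unique v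
    v-unique with _ ∷ v-unique ← m∷v-unique = v-unique
    v<m : All (_< m) v
    v<m with m≢v ∷ _ ← m∷v-unique
            | _ ∷ v≤m ← All-resp-↭ w↭m∷v (⊥≤max x xs ∷ xs≤max x xs) =
      All.zipWith (λ (m≢c , c≤m) → ≤∧≢⇒< c≤m (m≢c ∘ sym)) (m≢v , v≤m)
    |v|≡n : length v ≡ n
    |v|≡n = suc-injective (trans (sym (↭-length w↭m∷v)) |w|≡1+n)

infix 4 _≺_ _≺?_

_≺_ : List ℕ → List ℕ → Set
xs ≺ ys = All (λ x → All (x <_) ys) xs

_≺?_ : ∀ P S → Dec (P ≺ S)
P ≺? S = All.all? (λ x → All.all? (x <?_) S) P

≺-[] : ∀ P → P ≺ []
≺-[] = All.universal (λ _ → [])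

≺-++⁻ˡ : ∀ {P} A {B} → P ≺ A ++ B → P ≺ A
≺-++⁻ˡ A = All.map (All.++⁻ˡ A)

≺-++⁻ʳ : ∀ {P} A {B} → P ≺ A ++ B → P ≺ B
≺-++⁻ʳ A = All.map (All.++⁻ʳ A)

≺-++⁺ : ∀ {P A B} → P ≺ A → P ≺ B → P ≺ A ++ B
≺-++⁺ P≺A P≺B = All.zipWith (λ (x<A , x<B) → All.++⁺ x<A x<B) (P≺A , P≺B)

data Cut : List ℕ → Set where
  cut : ∀ {P S} → P ≢ [] → S ≢ [] → P ≺ S → Cut (P ++ S)

≺⇒prefix-ranks-↭ : ∀ P {S} → Unique (P ++ S) → P ≺ S →
                   map (rank (P ++ S)) P ↭ range1 (length P)
≺⇒prefix-ranks-↭ P {S} unique P≺S = begin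
  map (rank (P ++ S)) P  ≡⟨ map-cong-local (All.map (rank-++-above P ∘ All.map <⇒≤) P≺S) ⟩
  reduce P               ↭⟨ reduce-↭-range1 P (Unique-++⁻ˡ P unique) ⟩
  range1 (length P)      ∎
  where open PermutationReasoning

-- An entry y of S below an entry x of P would have rank at most that of x, hence
-- a rank of some entry of P; by injectivity of ranks y would lie in P as well.
prefix-ranks-↭⇒≺ : ∀ P {S} → Unique (P ++ S) →
                   map (rank (P ++ S)) P ↭ range1 (length P) → P ≺ S
prefix-ranks-↭⇒≺ P {S} unique ranks↭ =
  All.tabulate λ x∈P → All.tabulate λ y∈S → below x∈P y∈S
  where
  w : List ℕ
  w = P ++ S
  below : ∀ {x y} → x ∈ P → y ∈ S → x < y
  below {x} {y} x∈P y∈S with x <? y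
  ... | yes x<y = x<y
  ... | no x≮y with ∈-map⁻ (rank w) (∈-resp-↭ (↭-sym ranks↭) (∈-range1⁺ rank-y-bound))
    where
    rank-x-bound : countBelow x w < length P
    rank-x-bound = ∈-range1⁻ (∈-resp-↭ ranks↭ (∈-map⁺ (rank w) x∈P))
    rank-y-bound : countBelow y w < length P
    rank-y-bound = ≤-<-trans (countBelow-mono w (≮⇒≥ x≮y)) rank-x-bound
  ... | z , z∈P , rank-y≡rank-z
    with refl ← rank-injective (∈-++⁺ʳ P y∈S) (∈-++⁺ˡ z∈P) rank-y≡rank-z =
    ⊥-elim (Unique-++⇒disjoint P unique z∈P y∈S)

cut⇒¬Indec : ∀ {w} → Unique w → Cut w → ¬ Indec w
cut⇒¬Indec unique (cut {P} {S} P≢[] S≢[] P≺S) indec =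
  indec (length P , ≢[]⇒0<length P≢[] , |P|<|reduce-w| , prefix↭)
  where
  r : ℕ → ℕ
  r = rank (P ++ S)
  |P|<|reduce-w| : length P < length (reduce (P ++ S))
  |P|<|reduce-w| = begin-strict
    length P                  <⟨ m<m+n (length P) (≢[]⇒0<length S≢[]) ⟩
    length P + length S       ≡⟨ length-++ P ⟨
    length (P ++ S)           ≡⟨ length-map r (P ++ S) ⟨
    length (reduce (P ++ S))  ∎
    where open ≤-Reasoning
  prefix↭ : take (length P) (reduce (P ++ S)) ↭ range1 (length P)
  prefix↭ = begin
    take (length P) (map r (P ++ S))  ≡⟨ take-map (length P) (P ++ S) ⟩
    map r (take (length P) (P ++ S))  ≡⟨ cong (map r) (take-length-++ P S) ⟩
    map r P                           ↭⟨ ≺⇒prefix-ranks-↭ P unique P≺S ⟩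
    range1 (length P)                 ∎
    where open PermutationReasoning

¬Cut⇒Indec : ∀ {w} → Unique w → ¬ Cut w → Indec w
¬Cut⇒Indec {w} unique ¬cut (j , 0<j , j<|reduce-w| , prefix↭) =
  ¬cut (subst Cut P++S≡w (cut P≢[] S≢[] P≺S))
  where
  P S : List ℕ
  P = take j w
  S = drop j w
  P++S≡w : P ++ S ≡ w
  P++S≡w = take++drop≡id j w
  j<|w| : j < length w
  j<|w| = subst (j <_) (length-map (rank w) w) j<|reduce-w|
  |P|≡j : length P ≡ j
  |P|≡j = trans (length-take j w) (m≤n⇒m⊓n≡m (<⇒≤ j<|w|))
  P≢[] : P ≢ []
  P≢[] = 0<length⇒≢[] (subst (0 <_) (sym |P|≡j) 0<j)
  S≢[] : S ≢ []
  S≢[] = 0<length⇒≢[] (subst (0 <_) (sym (length-drop j w)) (m<n⇒0<n∸m j<|w|))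
  P≺S : P ≺ S
  P≺S = prefix-ranks-↭⇒≺ P (subst Unique (sym P++S≡w) unique)
          (subst₂ (λ v k → map (rank v) P ↭ range1 k) (sym P++S≡w) (sym |P|≡j)
            (↭-trans (↭-reflexive (sym (take-map j w))) prefix↭))

NoCutInside : List ℕ → List ℕ → Set
NoCutInside P S = ∀ {Q R} → P ≡ Q ++ R → Q ≢ [] → R ≢ [] → ¬ Q ≺ R ++ S

noCutInside-[_] : ∀ x {S} → NoCutInside [ x ] S
noCutInside-[ x ] {Q = []}          _ Q≢[] _    _ = Q≢[] refl
noCutInside-[ x ] {Q = _ ∷ []} {[]} _ _    R≢[] _ = R≢[] refl

noCutInside-∷ʳ : ∀ {P s S} → NoCutInside P (s ∷ S) → ¬ P ≺ s ∷ S → NoCutInside (P ∷ʳ s) S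
noCutInside-∷ʳ {P} {s} {S} noCut P⊀ {Q} {R} P∷ʳs≡Q++R Q≢[] R≢[] Q≺R++S with initLast R
... | [] = R≢[] refl
... | R′ ∷ʳ′ r
  with P≡Q++R′ , refl ← ∷ʳ-injective P (Q ++ R′) (trans P∷ʳs≡Q++R (sym (++-assoc Q R′ [ r ])))
  with R′
... | []           = P⊀ (subst (_≺ s ∷ S) (sym (trans P≡Q++R′ (++-identityʳ Q))) Q≺R++S)
... | R″@(_ ∷ _)   = noCut P≡Q++R′ Q≢[] (λ ()) (subst (Q ≺_) (++-assoc R″ [ s ] S) Q≺R++S)

firstCut : ∀ P S → P ≢ [] → NoCutInside P S →
           ∃₂ λ Q R → P ++ S ≡ Q ++ R × Q ≢ [] × Q ≺ R × NoCutInside Q R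
firstCut P []      P≢[] noCut = P , [] , refl , P≢[] , ≺-[] P , noCut
firstCut P (s ∷ S) P≢[] noCut with P ≺? (s ∷ S)
... | yes P≺ = P , s ∷ S , refl , P≢[] , P≺ , noCut
... | no P⊀
  with Q , R , eq , rest ← firstCut (P ∷ʳ s) S (∷ʳ≢[] P s) (noCutInside-∷ʳ noCut P⊀) =
  Q , R , trans (sym (++-assoc P [ s ] S)) eq , rest

noCutInside⇒¬Cut : ∀ {Q R} → Q ≺ R → NoCutInside Q R → ¬ Cut Q
noCutInside⇒¬Cut Q≺R noCut (cut {Q₁} Q₁≢[] Q₂≢[] Q₁≺Q₂) =
  noCut refl Q₁≢[] Q₂≢[] (≺-++⁺ Q₁≺Q₂ (All.++⁻ˡ Q₁ Q≺R))

indecPrefix-≺ : ∀ {w} → Unique w → w ≢ [] →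
                ∃₂ λ Q R → w ≡ Q ++ R × Q ≢ [] × Indec Q × Q ≺ R
indecPrefix-≺ {[]}     _      w≢[] = ⊥-elim (w≢[] refl)
indecPrefix-≺ {x ∷ xs} unique _
  with Q , R , w≡Q++R , Q≢[] , Q≺R , noCut ← firstCut [ x ] xs (λ ()) noCutInside-[ x ] =
  Q , R , w≡Q++R , Q≢[] , Q-indec , Q≺R
  where
  Q-indec : Indec Q
  Q-indec = ¬Cut⇒Indec (Unique-++⁻ˡ Q (subst Unique w≡Q++R unique)) (noCutInside⇒¬Cut Q≺R noCut)

-- The indecomposable prefix q below the rest is no longer than p; were it
-- shorter, it would cut p.
longestIndecPrefix-≺ : ∀ {p u} → Unique (p ++ u) → IsLongestIndecPrefix p (p ++ u) → p ≺ u
longestIndecPrefix-≺ {p} {u} unique (p≢[] , _ , p-indec , longest)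
  with q , r , p++u≡q++r , q≢[] , q-indec , q≺r ← indecPrefix-≺ unique (++≢[] p≢[])
  with ++-prefix-split q r p u (sym p++u≡q++r) (longest q q≢[] (r , p++u≡q++r) q-indec)
... | []        , refl , refl = subst (_≺ u) (sym (++-identityʳ q)) q≺r
... | m@(_ ∷ _) , refl , refl =
  ⊥-elim (cut⇒¬Indec (Unique-++⁻ˡ p unique) (cut q≢[] (λ ()) (≺-++⁻ˡ m q≺r)) p-indec)

components-last-≺ : ∀ {w pre c} → Unique w → Components w (pre ∷ʳ c) →
                    ∃ λ A → w ≡ A ++ c × A ≺ c
components-last-≺ {pre = []}    {c} _      (step _ done) = [] , ++-identityʳ c , []
components-last-≺ {pre = p ∷ _} {c} unique (step p-longest comps)
  with A , refl , A≺c ← components-last-≺ (Unique-++⁻ʳ p unique) comps =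
  p ++ A , sym (++-assoc p A c) , All.++⁺ (≺-++⁻ʳ A (longestIndecPrefix-≺ unique p-longest)) A≺c

components-indec : ∀ {w cs} → Components w cs → All (λ c → c ≢ [] × Indec c) cs
components-indec done                                  = []
components-indec (step (p≢[] , _ , p-indec , _) comps) = (p≢[] , p-indec) ∷ components-indec comps

indecSuffix-≺⇒max : ∀ {w A c} → Unique w → w ≡ A ++ c → A ≺ c → c ≢ [] → Indec c →
                    IsMaxIndecSuffix c w
indecSuffix-≺⇒max {w} {A} {c} unique w≡A++c A≺c c≢[] c-indec =
  (c≢[] , A , w≡A++c) , c-indec , longest
  where
  longest : ∀ s → IsSuffix s w → Indec s → length s ≤ length c
  longest s (_ , B , w≡B++s) s-indec with ≤-total (length A) (length B)
  ... | inj₁ |A|≤|B|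
    with m , _ , c≡m++s ← ++-prefix-split A c B s (trans (sym w≡A++c) w≡B++s) |A|≤|B| =
    subst (λ l → length s ≤ length l) (sym c≡m++s) (length-++-≤ʳ s {m})
  ... | inj₂ |B|≤|A| with ++-prefix-split B s A c (trans (sym w≡B++s) w≡A++c) |B|≤|A|
  ...   | []    , _    , s≡c  = ≤-reflexive (cong length s≡c)
  ...   | _ ∷ _ , refl , refl =
    ⊥-elim (cut⇒¬Indec (Unique-++⁻ʳ B (subst Unique w≡B++s unique))
                       (cut (λ ()) c≢[] (All.++⁻ʳ B A≺c)) s-indec)

lemma4p7 : (n : ℕ) (π : List ℕ) → IsPerm n π →
           (pre : List (List ℕ)) (πq : List ℕ) →
           Components π (pre ∷ʳ πq) → IsMaxIndecSuffix πq π
lemma4p7 _ _ π↭range _ _ comps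
  with unique ← IsPerm⇒Unique π↭range
  with A , π≡A++πq , A≺πq ← components-last-≺ unique comps
  with _ , (πq≢[] , πq-indec) ← All.∷ʳ⁻ (components-indec comps) =
  indecSuffix-≺⇒max unique π≡A++πq A≺πq πq≢[] πq-indec
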